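{- Let $\mathcal{W}^{\le}$ be the set of Dyck paths whose sequence of valley heights, read from left to right, is weakly increasing. For $D$ a Dyck path let $|D|$ be its semilength and $\mathrm{sp}'(D)$ the number of pairs of consecutive valleys of $D$ at the same height. Then $$\sum_{D\in\mathcal{W}^{\le}}t^{\mathrm{sp}'(D)}z^{|D|}=\frac{1-(1+t)z}{1-(2+t)z+tz^2}.$$
   Context: A Dyck path of semilength $n$ is a lattice path with steps $\mathbf{u}=(1,1)$ and $\mathbf{d}=(1,-1)$ from $(0,0)$ to $(2n,0)$ never going below the $x$-axis. A valley is an occurrence of consecutive steps $\mathbf{du}$; its height is the $y$-coordinate of its lowest vertex. Two valleys are consecutive if no other valley lies between them. Paths with no valleys belong to $\mathcal{W}^\le$. -}

module Defs where

open import Data.Bool using (Bool; true; false; _∧_; if_then_else_)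
open import Data.Nat using (ℕ; zero; suc; _∸_; _≡ᵇ_; _≤ᵇ_; _*_; _+_)
open import Data.List using (List; []; _∷_; map; _++_; length; upTo; foldr)
open import Data.Integer as ℤ using (ℤ; +_)

-- Dyck paths, encoded as words in the steps u = (1,1) and d = (1,-1).

data Step : Set where
  u d : Step

words : ℕ → List (List Step)
words zero    = [] ∷ []
words (suc m) = map (u ∷_) (words m) ++ map (d ∷_) (words m)

dyckFrom : ℕ → List Step → Bool
dyckFrom zero    []      = true
dyckFrom (suc _) []      = false
dyckFrom h       (u ∷ s) = dyckFrom (suc h) s
dyckFrom zero    (d ∷ s) = false
dyckFrom (suc h) (d ∷ s) = dyckFrom h s

isDyck : List Step → Bool
isDyck = dyckFrom 0

-- The height of a valley is the y-coordinate
-- of its lowest vertex, i.e. the height after the d step.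
valleysFrom : ℕ → List Step → List ℕ
valleysFrom h []                  = []
valleysFrom h (u ∷ s)             = valleysFrom (suc h) s
valleysFrom h (d ∷ rest@(u ∷ s))  = (h ∸ 1) ∷ valleysFrom (h ∸ 1) rest
valleysFrom h (d ∷ rest)          = valleysFrom (h ∸ 1) rest

valleyHeights : List Step → List ℕ
valleyHeights = valleysFrom 0

weaklyIncreasing : List ℕ → Bool
weaklyIncreasing []                = true
weaklyIncreasing (x ∷ [])          = true
weaklyIncreasing (x ∷ rest@(y ∷ _)) = (x ≤ᵇ y) ∧ weaklyIncreasing rest

equalAdjacent : List ℕ → ℕ
equalAdjacent []                 = 0
equalAdjacent (x ∷ [])           = 0
equalAdjacent (x ∷ rest@(y ∷ _)) =
  (if x ≡ᵇ y then 1 else 0) + equalAdjacent rest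

sp′ : List Step → ℕ
sp′ D = equalAdjacent (valleyHeights D)

-- Membership in W^≤ (for a word already known to be a Dyck path).
inW≤ : List Step → Bool
inW≤ D = weaklyIncreasing (valleyHeights D)

count : {A : Set} → (A → Bool) → List A → ℕ
count p []       = 0
count p (x ∷ xs) with p x
... | true  = suc (count p xs)
... | false = count p xs

a : ℕ → ℕ → ℕ
a n k = count (λ D → isDyck D ∧ inW≤ D ∧ (sp′ D ≡ᵇ k)) (words (2 * n))

-- Formal power series in z and t with integer coefficients:
-- S n k is the coefficient of z^n t^k.

Series : Set
Series = ℕ → ℕ → ℤ

infixl 6 _⊕_ _⊖_
infixl 7 _⊛_

_⊕_ : Series → Series → Series
(f ⊕ g) n k = f n k ℤ.+ g n k

_⊖_ : Series → Series → Series
(f ⊖ g) n k = f n k ℤ.- g n k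

sumℤ : List ℤ → ℤ
sumℤ = foldr ℤ._+_ (+ 0)

_⊛_ : Series → Series → Series
(f ⊛ g) n k =
  sumℤ (map (λ i → sumℤ (map (λ j → f i j ℤ.* g (n ∸ i) (k ∸ j)) (upTo (suc k)))) (upTo (suc n)))

oneS : Series
oneS zero zero = + 1
oneS _    _    = + 0

zS : Series
zS (suc zero) zero = + 1
zS _          _    = + 0

tS : Series
tS zero (suc zero) = + 1
tS _    _          = + 0

twoS : Series
twoS = oneS ⊕ oneS

F : Series
F n k = + a n k

module Submission where

-- All that matters about the part already read is its
-- height h, whether its last step was d (so that a following u closes a valley at height h)
-- and the height of its last valley; the polynomial in t counting the admissible completions
-- of such a state therefore obeys a transfer recursion over the next step.  A completion
-- whose valleys all lie at height ≥ v never dips below v before its final descent, so the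
-- states after a valley at height v are copies of the state after a valley at height 0.
-- Writing fromValley r for the completions of length 2r + 1 of the latter and S₁, S₂ for its
-- first and second partial sums, one solves fromValley r = 1 + t S₁ r + S₂ r and
-- a (r + 1) = 1 + S₁ r + S₂ r.  Eliminating S₁ and S₂ gives a (n + 2) + t a n = (2 + t) a (n + 1),
-- with a 0 = a 1 = 1, which is the coefficientwise form of
-- (1 - (2 + t) z + t z²) F = 1 - (1 + t) z.

open import Defs
open import Data.Nat as ℕ using (ℕ; zero; suc)
open import Relation.Binary.PropositionalEquality

module Enumeration where

  open import Data.Bool using (Bool; true; false; _∧_; if_then_else_)
  open import Data.Bool.Properties using (∧-zeroʳ)
  open import Data.Maybe using (Maybe; nothing; just)
  open import Data.List using (List; []; _∷_; map; _++_; fromMaybe)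
  open import Data.Nat using (_+_; _*_; _≤ᵇ_; _≡ᵇ_; _<_; s≤s)
  open import Data.Nat.Properties
  open import Data.Nat.Tactic.RingSolver using (solve-∀)
  open import Function using (_∘_)
  open import Relation.Nullary.Reflects using (det; fromEquivalence; ofⁿ)
  open ≡-Reasoning

  count-++ : {A : Set} (p : A → Bool) (xs ys : List A) →
             count p (xs ++ ys) ≡ count p xs + count p ys
  count-++ p []       ys = refl
  count-++ p (x ∷ xs) ys with p x
  ... | true  = cong suc (count-++ p xs ys)
  ... | false = count-++ p xs ys

  count-map : {A B : Set} (p : B → Bool) (f : A → B) (xs : List A) →
              count p (map f xs) ≡ count (p ∘ f) xs
  count-map p f []       = refl
  count-map p f (x ∷ xs) with p (f x)
  ... | true  = cong suc (count-map p f xs)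
  ... | false = count-map p f xs

  count-cong : {A : Set} {p q : A → Bool} → (∀ x → p x ≡ q x) → (xs : List A) →
               count p xs ≡ count q xs
  count-cong             p≗q []       = refl
  count-cong {p = p} {q} p≗q (x ∷ xs) with p x | q x | p≗q x
  ... | true  | true  | _ = cong suc (count-cong p≗q xs)
  ... | false | false | _ = count-cong p≗q xs

  count-none : {A : Set} {p : A → Bool} → (∀ x → p x ≡ false) → (xs : List A) → count p xs ≡ 0
  count-none         p≗false []       = refl
  count-none {p = p} p≗false (x ∷ xs) with p x | p≗false x
  ... | false | _ = count-none p≗false xs

  count-words-suc : (p : List Step → Bool) (L : ℕ) →
    count p (words (suc L)) ≡ count (p ∘ (u ∷_)) (words L) + count (p ∘ (d ∷_)) (words L)
  count-words-suc p L = begin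
    count p (map (u ∷_) (words L) ++ map (d ∷_) (words L))
      ≡⟨ count-++ p (map (u ∷_) (words L)) (map (d ∷_) (words L)) ⟩
    count p (map (u ∷_) (words L)) + count p (map (d ∷_) (words L))
      ≡⟨ cong₂ _+_ (count-map p (u ∷_) (words L)) (count-map p (d ∷_) (words L)) ⟩
    count (p ∘ (u ∷_)) (words L) + count (p ∘ (d ∷_)) (words L) ∎

  -- A prefix is summarised by its final height h, its last step s and the height m of its
  -- last valley, if any.
  valleysAfter : Step → ℕ → List Step → List ℕ
  valleysAfter d h (u ∷ w) = h ∷ valleysFrom h (u ∷ w)
  valleysAfter _ h w       = valleysFrom h w

  admissible : Maybe ℕ → ℕ → List ℕ → Bool
  admissible m k vs = weaklyIncreasing (fromMaybe m ++ vs) ∧ (equalAdjacent (fromMaybe m ++ vs) ≡ᵇ k)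

  isCompletion : ℕ → Step → Maybe ℕ → ℕ → List Step → Bool
  isCompletion h s m k w = dyckFrom h w ∧ admissible m k (valleysAfter s h w)

  δ₀ : ℕ → ℕ
  δ₀ zero    = 1
  δ₀ (suc _) = 0

  t·_ : (ℕ → ℕ) → ℕ → ℕ
  (t· f) zero    = 0
  (t· f) (suc k) = f k

  newValley : Maybe ℕ → ℕ → (ℕ → ℕ) → ℕ → ℕ
  newValley nothing  h f = f
  newValley (just x) h f = if x ≤ᵇ h then (if x ≡ᵇ h then t· f else f) else λ _ → 0

  completions : ℕ → Step → Maybe ℕ → ℕ → ℕ → ℕ
  completions zero    _ _ zero      = δ₀
  completions (suc _) _ _ zero      = λ _ → 0
  completions zero    u m (suc L)   = completions 1 u m L
  completions (suc h) u m (suc L) k = completions (suc (suc h)) u m L k + completions h d m L k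
  completions zero    d m (suc L)   = newValley m 0 (completions 1 u (just 0) L)
  completions (suc h) d m (suc L) k =
    newValley m (suc h) (completions (suc (suc h)) u (just (suc h)) L) k + completions h d m L k

  dyckFrom-u : ∀ h w → dyckFrom h (u ∷ w) ≡ dyckFrom (suc h) w
  dyckFrom-u zero    w = refl
  dyckFrom-u (suc h) w = refl

  valleysAfter-d : ∀ s h w → valleysAfter s (suc h) (d ∷ w) ≡ valleysAfter d h w
  valleysAfter-d u h []      = refl
  valleysAfter-d u h (u ∷ w) = refl
  valleysAfter-d u h (d ∷ w) = refl
  valleysAfter-d d h []      = refl
  valleysAfter-d d h (u ∷ w) = refl
  valleysAfter-d d h (d ∷ w) = refl

  t·-cong : ∀ {f g} → (∀ k → f k ≡ g k) → ∀ k → (t· f) k ≡ (t· g) k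
  t·-cong f≗g zero    = refl
  t·-cong f≗g (suc k) = f≗g k

  t·-zero : ∀ {f} → (∀ k → f k ≡ 0) → ∀ k → (t· f) k ≡ 0
  t·-zero f≗0 zero    = refl
  t·-zero f≗0 (suc k) = f≗0 k

  t·-+ : ∀ f g k → (t· λ k → f k + g k) k ≡ (t· f) k + (t· g) k
  t·-+ f g zero    = refl
  t·-+ f g (suc k) = refl

  newValley-cong : ∀ m h {f g} → (∀ k → f k ≡ g k) → ∀ k → newValley m h f k ≡ newValley m h g k
  newValley-cong nothing  h f≗g k = f≗g k
  newValley-cong (just x) h f≗g k with x ≤ᵇ h | x ≡ᵇ h
  ... | false | _     = refl
  ... | true  | false = f≗g k
  ... | true  | true  = t·-cong f≗g k

  newValley-zero : ∀ m h {f} → (∀ k → f k ≡ 0) → ∀ k → newValley m h f k ≡ 0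
  newValley-zero nothing  h f≗0 k = f≗0 k
  newValley-zero (just x) h f≗0 k with x ≤ᵇ h | x ≡ᵇ h
  ... | false | _     = refl
  ... | true  | false = f≗0 k
  ... | true  | true  = t·-zero f≗0 k

  count-dyckFrom-u : ∀ L h (q : List Step → Bool) →
    count (λ w → dyckFrom h (u ∷ w) ∧ q w) (words L) ≡ count (λ w → dyckFrom (suc h) w ∧ q w) (words L)
  count-dyckFrom-u L h q = count-cong (λ w → cong (_∧ q w) (dyckFrom-u h w)) (words L)

  count-valley : ∀ L h m k →
    count (isCompletion h d m k ∘ (u ∷_)) (words L) ≡
    newValley m h (λ k → count (isCompletion (suc h) u (just h) k) (words L)) k
  count-valley L h nothing k = count-dyckFrom-u L h _
  count-valley L h (just x) k with x ≤ᵇ h | x ≡ᵇ h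
  ... | false | _     = count-none (λ w → ∧-zeroʳ (dyckFrom h (u ∷ w))) (words L)
  ... | true  | false = count-dyckFrom-u L h _
  count-valley L h (just x) (suc k) | true | true = count-dyckFrom-u L h _
  count-valley L h (just x) zero    | true | true =
    count-none (λ w → trans (cong (dyckFrom h (u ∷ w) ∧_) (∧-zeroʳ (weaklyIncreasing (h ∷ valleysFrom (suc h) w))))
                            (∧-zeroʳ (dyckFrom h (u ∷ w))))
               (words L)

  count-after-d : ∀ L h s m k →
    count (isCompletion (suc h) s m k ∘ (d ∷_)) (words L) ≡ count (isCompletion h d m k) (words L)
  count-after-d L h s m k =
    count-cong (λ w → cong (λ vs → dyckFrom h w ∧ admissible m k vs) (valleysAfter-d s h w)) (words L)

  count-isCompletion : ∀ L h s m k → count (isCompletion h s m k) (words L) ≡ completions h s m L k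
  count-isCompletion zero    (suc h) s m        k       = refl
  count-isCompletion zero    zero    u nothing  zero    = refl
  count-isCompletion zero    zero    u nothing  (suc k) = refl
  count-isCompletion zero    zero    u (just x) zero    = refl
  count-isCompletion zero    zero    u (just x) (suc k) = refl
  count-isCompletion zero    zero    d nothing  zero    = refl
  count-isCompletion zero    zero    d nothing  (suc k) = refl
  count-isCompletion zero    zero    d (just x) zero    = refl
  count-isCompletion zero    zero    d (just x) (suc k) = refl
  count-isCompletion (suc L) h s m k = trans (count-words-suc (isCompletion h s m k) L) (by-first-step h s)
    where
    up : ℕ → Step → ℕ
    up h s = count (isCompletion h s m k ∘ (u ∷_)) (words L)
    down : ℕ → Step → ℕ
    down h s = count (isCompletion h s m k ∘ (d ∷_)) (words L)
    by-first-step : ∀ h s → up h s + down h s ≡ completions h s m (suc L) k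
    by-first-step zero u =
      trans (cong₂ _+_ (trans (count-dyckFrom-u L 0 _) (count-isCompletion L 1 u m k))
                       (count-none (λ _ → refl) (words L)))
            (+-identityʳ _)
    by-first-step zero d =
      trans (cong₂ _+_ (trans (count-valley L 0 m k) (newValley-cong m 0 (count-isCompletion L 1 u (just 0)) k))
                       (count-none (λ _ → refl) (words L)))
            (+-identityʳ _)
    by-first-step (suc h) u =
      cong₂ _+_ (trans (count-dyckFrom-u L (suc h) _) (count-isCompletion L (suc (suc h)) u m k))
                (trans (count-after-d L h u m k) (count-isCompletion L h d m k))
    by-first-step (suc h) d =
      cong₂ _+_ (trans (count-valley L (suc h) m k)
                       (newValley-cong m (suc h) (count-isCompletion L (suc (suc h)) u (just (suc h))) k))
                (trans (count-after-d L h d m k) (count-isCompletion L h d m k))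

  completions-short : ∀ {L h} s m k → L < h → completions h s m L k ≡ 0
  completions-short {zero}  {suc h} s m k _ = refl
  completions-short {suc L} {suc h} u m k (s≤s L<h) =
    cong₂ _+_ (completions-short u m k (m<n⇒m<1+n (m<n⇒m<1+n L<h))) (completions-short d m k L<h)
  completions-short {suc L} {suc h} d m k (s≤s L<h) =
    cong₂ _+_ (newValley-zero m (suc h)
                              (λ k → completions-short u (just (suc h)) k (m<n⇒m<1+n (m<n⇒m<1+n L<h))) k)
              (completions-short d m k L<h)

  completions-descent : ∀ h s m k → completions h s m h k ≡ δ₀ k
  completions-descent zero    s m k = refl
  completions-descent (suc h) u m k =
    trans (cong (_+ completions h d m h k) (completions-short u m k (m<n⇒m<1+n (n<1+n h))))
          (completions-descent h d m k)
  completions-descent (suc h) d m k =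
    trans (cong (_+ completions h d m h k)
                (newValley-zero m (suc h) (λ k → completions-short u (just (suc h)) k (m<n⇒m<1+n (n<1+n h))) k))
          (completions-descent h d m k)

  >⇒≤ᵇ≡false : ∀ {x h} → h < x → (x ≤ᵇ h) ≡ false
  >⇒≤ᵇ≡false {x} {h} h<x = det (≤ᵇ-reflects-≤ x h) (ofⁿ (<⇒≱ h<x))

  completions-blocked : ∀ {L h x} k → h < x → h < L → completions h d (just x) L k ≡ 0
  completions-blocked {suc L} {zero}  {suc x} k _ _ = refl
  completions-blocked {suc L} {suc h} {x}     k h<x (s≤s h<L) rewrite >⇒≤ᵇ≡false h<x =
    completions-blocked k (<-trans (n<1+n h) h<x) h<L

  +-cancelʳ-≤ᵇ : ∀ x h v → (x + v ≤ᵇ h + v) ≡ (x ≤ᵇ h)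
  +-cancelʳ-≤ᵇ x h v =
    det (fromEquivalence (λ le → +-cancelʳ-≤ v x h (≤ᵇ⇒≤ _ _ le)) (λ le → ≤⇒≤ᵇ (+-monoˡ-≤ v le)))
        (≤ᵇ-reflects-≤ x h)

  +-cancelʳ-≡ᵇ : ∀ x h v → (x + v ≡ᵇ h + v) ≡ (x ≡ᵇ h)
  +-cancelʳ-≡ᵇ x h v =
    det (fromEquivalence (λ eq → +-cancelʳ-≡ v x h (≡ᵇ⇒≡ _ _ eq)) (λ eq → ≡⇒≡ᵇ _ _ (cong (_+ v) eq)))
        (fromEquivalence (≡ᵇ⇒≡ x h) (≡⇒≡ᵇ x h))

  newValley-raise : ∀ x h v f k → newValley (just (x + v)) (h + v) f k ≡ newValley (just x) h f k
  newValley-raise x h v f k rewrite +-cancelʳ-≤ᵇ x h v | +-cancelʳ-≡ᵇ x h v = refl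

  -- Every valley of a completion lies at height ≥ x + v, so before its final descent the
  -- completion never goes below v: lowering it by v is a bijection.
  completions-raise : ∀ L h s x v k →
    completions (h + v) s (just (x + v)) (L + v) k ≡ completions h s (just x) L k
  completions-raise zero    zero    s x v k = completions-descent v s (just (x + v)) k
  completions-raise zero    (suc h) s x v k = completions-short s (just (x + v)) k (s≤s (m≤n+m v h))
  completions-raise (suc L) zero    s x zero    k rewrite +-identityʳ x | +-identityʳ L = refl
  completions-raise (suc L) zero    u x (suc v) k =
    trans (cong₂ _+_ (completions-raise L 1 u x (suc v) k)
                     (completions-blocked k (m≤n+m (suc v) x) (m≤n+m (suc v) L)))
          (+-identityʳ _)
  completions-raise (suc L) zero    d x (suc v) k =
    trans (cong₂ _+_ (trans (newValley-raise x 0 (suc v) _ k)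
                            (newValley-cong (just x) 0 (completions-raise L 1 u 0 (suc v)) k))
                     (completions-blocked k (m≤n+m (suc v) x) (m≤n+m (suc v) L)))
          (+-identityʳ _)
  completions-raise (suc L) (suc h) u x v k =
    cong₂ _+_ (completions-raise L (suc (suc h)) u x v k) (completions-raise L h d x v k)
  completions-raise (suc L) (suc h) d x v k =
    cong₂ _+_ (trans (newValley-raise x (suc h) v _ k)
                     (newValley-cong (just x) (suc h) (completions-raise L (suc (suc h)) u (suc h) v) k))
              (completions-raise L h d x v k)

  completions-after-valley : ∀ h L k →
    completions (suc h) u (just h) (L + h) k ≡ completions 1 u (just 0) L k
  completions-after-valley h L k = completions-raise L 1 u 0 h k

  data Grounded : Maybe ℕ → Set where
    none   : Grounded nothing
    atZero : Grounded (just 0)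

  newValley-above : ∀ {m} → Grounded m → ∀ h f k → newValley m (suc h) f k ≡ f k
  newValley-above none   h f k = refl
  newValley-above atZero h f k = refl

  newValley-grounded-+ : ∀ {m} → Grounded m → ∀ f g k →
    newValley m 0 (λ k → f k + g k) k ≡ newValley m 0 f k + newValley m 0 g k
  newValley-grounded-+ none   f g k = refl
  newValley-grounded-+ atZero f g k = t·-+ f g k

  completions-down : ∀ {m} → Grounded m → ∀ h L k →
    completions h d m (h + suc L) k ≡
    h * completions 1 u (just 0) L k + newValley m 0 (completions 1 u (just 0) L) k
  completions-down g zero    L k = refl
  completions-down {m} g (suc h) L k = begin
    newValley m (suc h) (completions (suc (suc h)) u (just (suc h)) (h + suc L)) k + completions h d m (h + suc L) k
      ≡⟨ cong₂ _+_ (newValley-above g h _ k) (completions-down g h L k) ⟩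
    completions (suc (suc h)) u (just (suc h)) (h + suc L) k + rest
      ≡⟨ cong (λ L′ → completions (suc (suc h)) u (just (suc h)) L′ k + rest) (+-comm-suc h L) ⟩
    completions (suc (suc h)) u (just (suc h)) (L + suc h) k + rest
      ≡⟨ cong (_+ rest) (completions-after-valley (suc h) L k) ⟩
    e + (h * e + newValley m 0 E k)
      ≡⟨ +-assoc e (h * e) (newValley m 0 E k) ⟨
    suc h * e + newValley m 0 E k ∎
    where
    E = completions 1 u (just 0) L
    e = E k
    rest = h * e + newValley m 0 E k
    +-comm-suc : ∀ h L → h + suc L ≡ L + suc h
    +-comm-suc h L = trans (+-suc h L) (trans (cong suc (+-comm h L)) (sym (+-suc L h)))

  fromValley : ℕ → ℕ → ℕ
  fromValley r = completions 1 u (just 0) (suc (r + r))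

  partialSums : (ℕ → ℕ → ℕ) → ℕ → ℕ → ℕ
  partialSums f zero    k = 0
  partialSums f (suc r) k = partialSums f r k + f r k

  S₁ S₂ : ℕ → ℕ → ℕ
  S₁ = partialSums fromValley
  S₂ = partialSums S₁

  completions-up : ∀ {m} → Grounded m → ∀ r h k →
    completions (suc h) u m (suc h + (r + r)) k ≡ δ₀ k + h * S₁ r k + newValley m 0 (S₁ r) k + S₂ r k
  completions-up {m} g zero h k = begin
    completions (suc h) u m (suc h + 0) k   ≡⟨ cong (λ L → completions (suc h) u m L k) (+-identityʳ (suc h)) ⟩
    completions (suc h) u m (suc h) k       ≡⟨ completions-descent (suc h) u m k ⟩
    δ₀ k                                    ≡⟨ pad (δ₀ k) h ⟩
    δ₀ k + h * 0 + 0 + 0                    ≡⟨ cong (λ z → δ₀ k + h * 0 + z + 0) (newValley-zero m 0 (λ _ → refl) k) ⟨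
    δ₀ k + h * 0 + newValley m 0 (S₁ 0) k + 0 ∎
    where
    pad : ∀ x h → x ≡ x + h * 0 + 0 + 0
    pad = solve-∀
  completions-up {m} g (suc r) h k = begin
    completions (suc h) u m (suc h + (suc r + suc r)) k
      ≡⟨ cong (λ L → completions (suc h) u m L k) (split-up h r) ⟩
    completions (suc (suc h)) u m (suc (suc h) + (r + r)) k + completions h d m (suc (suc h) + (r + r)) k
      ≡⟨ cong (completions (suc (suc h)) u m (suc (suc h) + (r + r)) k +_)
              (cong (λ L → completions h d m L k) (split-down h r)) ⟩
    completions (suc (suc h)) u m (suc (suc h) + (r + r)) k + completions h d m (h + suc (suc (r + r))) k
      ≡⟨ cong₂ _+_ (completions-up g r (suc h) k) (completions-down g h (suc (r + r)) k) ⟩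
    (δ₀ k + suc h * S₁ r k + V₁ + S₂ r k) + (h * fromValley r k + V)
      ≡⟨ regroup (δ₀ k) h (S₁ r k) V₁ (S₂ r k) (fromValley r k) V ⟩
    δ₀ k + h * (S₁ r k + fromValley r k) + (V₁ + V) + (S₂ r k + S₁ r k)
      ≡⟨ cong (λ z → δ₀ k + h * S₁ (suc r) k + z + S₂ (suc r) k)
              (newValley-grounded-+ g (S₁ r) (fromValley r) k) ⟨
    δ₀ k + h * S₁ (suc r) k + newValley m 0 (S₁ (suc r)) k + S₂ (suc r) k ∎
    where
    V₁ = newValley m 0 (S₁ r) k
    V = newValley m 0 (fromValley r) k
    split-up : ∀ h r → suc h + (suc r + suc r) ≡ suc (suc (suc h) + (r + r))
    split-up = solve-∀
    split-down : ∀ h r → suc (suc h) + (r + r) ≡ h + suc (suc (r + r))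
    split-down = solve-∀
    regroup : ∀ o h p v q e w → (o + suc h * p + v + q) + (h * e + w) ≡ o + h * (p + e) + (v + w) + (q + p)
    regroup = solve-∀

  fromValley-partialSums : ∀ r k → fromValley r k ≡ δ₀ k + (t· S₁ r) k + S₂ r k
  fromValley-partialSums r k =
    trans (completions-up atZero r 0 k) (cong (λ z → z + (t· S₁ r) k + S₂ r k) (+-identityʳ (δ₀ k)))

  a-suc-partialSums : ∀ n k → a (suc n) k ≡ δ₀ k + S₁ n k + S₂ n k
  a-suc-partialSums n k = begin
    a (suc n) k                              ≡⟨ count-isCompletion (2 * suc n) 0 u nothing k ⟩
    completions 0 u nothing (2 * suc n) k    ≡⟨ cong (λ L → completions 0 u nothing L k) (double-suc n) ⟩
    completions 1 u nothing (1 + (n + n)) k  ≡⟨ completions-up none n 0 k ⟩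
    δ₀ k + 0 + S₁ n k + S₂ n k               ≡⟨ cong (λ z → z + S₁ n k + S₂ n k) (+-identityʳ (δ₀ k)) ⟩
    δ₀ k + S₁ n k + S₂ n k                   ∎
    where
    double-suc : ∀ n → 2 * suc n ≡ suc (1 + (n + n))
    double-suc = solve-∀

  a-suc-suc : ∀ n k → a (2 + n) k ≡ a (1 + n) k + S₁ (1 + n) k
  a-suc-suc n k = begin
    a (2 + n) k                                          ≡⟨ a-suc-partialSums (suc n) k ⟩
    δ₀ k + (S₁ n k + fromValley n k) + (S₂ n k + S₁ n k) ≡⟨ regroup (δ₀ k) (S₁ n k) (fromValley n k) (S₂ n k) ⟩
    (δ₀ k + S₁ n k + S₂ n k) + (S₁ n k + fromValley n k) ≡⟨ cong (_+ S₁ (1 + n) k) (a-suc-partialSums n k) ⟨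
    a (1 + n) k + S₁ (1 + n) k                           ∎
    where
    regroup : ∀ o p e q → o + (p + e) + (q + p) ≡ (o + p + q) + (p + e)
    regroup = solve-∀

  S₁-+-fromValley : ∀ n k → S₁ n k + fromValley n k ≡ a (1 + n) k + (t· S₁ n) k
  S₁-+-fromValley n k = begin
    S₁ n k + fromValley n k                 ≡⟨ cong (S₁ n k +_) (fromValley-partialSums n k) ⟩
    S₁ n k + (δ₀ k + (t· S₁ n) k + S₂ n k)  ≡⟨ regroup (S₁ n k) (δ₀ k) ((t· S₁ n) k) (S₂ n k) ⟩
    δ₀ k + S₁ n k + S₂ n k + (t· S₁ n) k    ≡⟨ cong (_+ (t· S₁ n) k) (a-suc-partialSums n k) ⟨
    a (1 + n) k + (t· S₁ n) k               ∎
    where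
    regroup : ∀ p o t q → p + (o + t + q) ≡ o + p + q + t
    regroup = solve-∀

  a-recurrence : ∀ n k → a (2 + n) k + (t· a n) k ≡ a (1 + n) k + a (1 + n) k + (t· a (1 + n)) k
  a-recurrence zero    zero          = refl
  a-recurrence zero    (suc zero)    = refl
  a-recurrence zero    (suc (suc k)) = refl
  a-recurrence (suc m) k = begin
    a (3 + m) k + (t· a (1 + m)) k
      ≡⟨ cong (_+ (t· a (1 + m)) k) (a-suc-suc (suc m) k) ⟩
    a (2 + m) k + (S₁ (1 + m) k + fromValley (1 + m) k) + (t· a (1 + m)) k
      ≡⟨ cong (λ z → a (2 + m) k + z + (t· a (1 + m)) k) (S₁-+-fromValley (suc m) k) ⟩
    a (2 + m) k + (a (2 + m) k + (t· S₁ (1 + m)) k) + (t· a (1 + m)) k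
      ≡⟨ regroup (a (2 + m) k) ((t· S₁ (1 + m)) k) ((t· a (1 + m)) k) ⟩
    a (2 + m) k + a (2 + m) k + ((t· a (1 + m)) k + (t· S₁ (1 + m)) k)
      ≡⟨ cong (a (2 + m) k + a (2 + m) k +_)
              (trans (t·-cong (a-suc-suc m) k) (t·-+ (a (1 + m)) (S₁ (1 + m)) k)) ⟨
    a (2 + m) k + a (2 + m) k + (t· a (2 + m)) k ∎
    where
    regroup : ∀ x s y → x + (x + s) + y ≡ x + x + (y + s)
    regroup = solve-∀

module PowerSeries where

  open import Data.Bool using (_∧_; if_then_else_)
  open import Data.List using ([]; _∷_; map; upTo)
  open import Data.List.Properties using (map-applyUpTo; map-upTo)
  open import Data.Nat using (_∸_; _≡ᵇ_; _<_; z<s; s<s; s≤s⁻¹)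
  open import Data.Nat.Properties using (m∸[m∸n]≡n)
  open import Data.Integer using (ℤ; +_; _+_; _-_; _*_)
  open import Data.Integer.Properties
    using (+-identityˡ; +-identityʳ; +-comm; +-assoc; *-comm; *-identityˡ; *-distribʳ-+)
  open import Data.Integer.Tactic.RingSolver using (solve-∀)
  open import Function using (_∘_)
  open ≡-Reasoning

  ∑ : ℕ → (ℕ → ℤ) → ℤ
  ∑ m f = sumℤ (map f (upTo m))

  ∑-suc : ∀ m f → ∑ (suc m) f ≡ f 0 + ∑ m (f ∘ suc)
  ∑-suc m f = cong (λ xs → f 0 + sumℤ xs) (trans (map-applyUpTo suc f m) (sym (map-upTo (f ∘ suc) m)))

  ∑-sucʳ : ∀ m f → ∑ (suc m) f ≡ ∑ m f + f m
  ∑-sucʳ zero    f = trans (+-identityʳ (f 0)) (sym (+-identityˡ (f 0)))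
  ∑-sucʳ (suc m) f = begin
    ∑ (suc (suc m)) f                  ≡⟨ ∑-suc (suc m) f ⟩
    f 0 + ∑ (suc m) (f ∘ suc)          ≡⟨ cong (_+_ (f 0)) (∑-sucʳ m (f ∘ suc)) ⟩
    f 0 + (∑ m (f ∘ suc) + f (suc m))  ≡⟨ +-assoc (f 0) _ (f (suc m)) ⟨
    f 0 + ∑ m (f ∘ suc) + f (suc m)    ≡⟨ cong (_+ f (suc m)) (∑-suc m f) ⟨
    ∑ (suc m) f + f (suc m)            ∎

  ∑-reverse : ∀ n f → ∑ (suc n) f ≡ ∑ (suc n) (λ i → f (n ∸ i))
  ∑-reverse zero    f = refl
  ∑-reverse (suc n) f = begin
    ∑ (suc (suc n)) f                        ≡⟨ ∑-sucʳ (suc n) f ⟩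
    ∑ (suc n) f + f (suc n)                  ≡⟨ cong (_+ f (suc n)) (∑-reverse n f) ⟩
    ∑ (suc n) (λ i → f (n ∸ i)) + f (suc n)  ≡⟨ +-comm _ (f (suc n)) ⟩
    f (suc n) + ∑ (suc n) (λ i → f (n ∸ i))  ≡⟨ ∑-suc (suc n) (λ i → f (suc n ∸ i)) ⟨
    ∑ (suc (suc n)) (λ i → f (suc n ∸ i))    ∎

  ∑-cong : ∀ m {f g} → (∀ {i} → i < m → f i ≡ g i) → ∑ m f ≡ ∑ m g
  ∑-cong zero    f≗g = refl
  ∑-cong (suc m) {f} {g} f≗g = begin
    ∑ (suc m) f          ≡⟨ ∑-suc m f ⟩
    f 0 + ∑ m (f ∘ suc)  ≡⟨ cong₂ _+_ (f≗g z<s) (∑-cong m (f≗g ∘ s<s)) ⟩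
    g 0 + ∑ m (g ∘ suc)  ≡⟨ ∑-suc m g ⟨
    ∑ (suc m) g          ∎

  ∑-zero : ∀ m {f} → (∀ i → f i ≡ + 0) → ∑ m f ≡ + 0
  ∑-zero zero        f≗0 = refl
  ∑-zero (suc m) {f} f≗0 = trans (∑-suc m f) (cong₂ _+_ (f≗0 0) (∑-zero m (f≗0 ∘ suc)))

  sumℤ-map-+ : ∀ {A : Set} (f g : A → ℤ) xs →
    sumℤ (map (λ x → f x + g x) xs) ≡ sumℤ (map f xs) + sumℤ (map g xs)
  sumℤ-map-+ f g []       = refl
  sumℤ-map-+ f g (x ∷ xs) = trans (cong (_+_ (f x + g x)) (sumℤ-map-+ f g xs)) (interchange (f x) (g x) _ _)
    where
    interchange : ∀ a b c d → a + b + (c + d) ≡ a + c + (b + d)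
    interchange = solve-∀

  sumℤ-map-- : ∀ {A : Set} (f g : A → ℤ) xs →
    sumℤ (map (λ x → f x - g x) xs) ≡ sumℤ (map f xs) - sumℤ (map g xs)
  sumℤ-map-- f g []       = refl
  sumℤ-map-- f g (x ∷ xs) = trans (cong (_+_ (f x - g x)) (sumℤ-map-- f g xs)) (interchange (f x) (g x) _ _)
    where
    interchange : ∀ a b c d → a - b + (c - d) ≡ a + c - (b + d)
    interchange = solve-∀

  ⊛-congˡ : ∀ {f g} h → (∀ i j → f i j ≡ g i j) → ∀ n k → (f ⊛ h) n k ≡ (g ⊛ h) n k
  ⊛-congˡ h f≗g n k = ∑-cong (suc n) λ {i} _ → ∑-cong (suc k) λ {j} _ → cong (_* h (n ∸ i) (k ∸ j)) (f≗g i j)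

  ⊛-distribʳ-⊕ : ∀ f g h n k → ((f ⊕ g) ⊛ h) n k ≡ (f ⊛ h ⊕ g ⊛ h) n k
  ⊛-distribʳ-⊕ f g h n k = begin
    ∑ (suc n) (λ i → ∑ (suc k) (λ j → (f i j + g i j) * h′ i j))
      ≡⟨ ∑-cong (suc n) (λ {i} _ → ∑-cong (suc k) λ {j} _ → *-distribʳ-+ (h′ i j) (f i j) (g i j)) ⟩
    ∑ (suc n) (λ i → ∑ (suc k) (λ j → f i j * h′ i j + g i j * h′ i j))
      ≡⟨ ∑-cong (suc n) (λ {i} _ → sumℤ-map-+ (fh i) (gh i) (upTo (suc k))) ⟩
    ∑ (suc n) (λ i → ∑ (suc k) (fh i) + ∑ (suc k) (gh i))
      ≡⟨ sumℤ-map-+ (λ i → ∑ (suc k) (fh i)) (λ i → ∑ (suc k) (gh i)) (upTo (suc n)) ⟩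
    (f ⊛ h ⊕ g ⊛ h) n k ∎
    where
    h′ fh gh : ℕ → ℕ → ℤ
    h′ i j = h (n ∸ i) (k ∸ j)
    fh i j = f i j * h′ i j
    gh i j = g i j * h′ i j

  ⊛-distribʳ-⊖ : ∀ f g h n k → ((f ⊖ g) ⊛ h) n k ≡ (f ⊛ h ⊖ g ⊛ h) n k
  ⊛-distribʳ-⊖ f g h n k = begin
    ∑ (suc n) (λ i → ∑ (suc k) (λ j → (f i j - g i j) * h′ i j))
      ≡⟨ ∑-cong (suc n) (λ {i} _ → ∑-cong (suc k) λ {j} _ → distrib (f i j) (g i j) (h′ i j)) ⟩
    ∑ (suc n) (λ i → ∑ (suc k) (λ j → f i j * h′ i j - g i j * h′ i j))
      ≡⟨ ∑-cong (suc n) (λ {i} _ → sumℤ-map-- (fh i) (gh i) (upTo (suc k))) ⟩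
    ∑ (suc n) (λ i → ∑ (suc k) (fh i) - ∑ (suc k) (gh i))
      ≡⟨ sumℤ-map-- (λ i → ∑ (suc k) (fh i)) (λ i → ∑ (suc k) (gh i)) (upTo (suc n)) ⟩
    (f ⊛ h ⊖ g ⊛ h) n k ∎
    where
    h′ fh gh : ℕ → ℕ → ℤ
    h′ i j = h (n ∸ i) (k ∸ j)
    fh i j = f i j * h′ i j
    gh i j = g i j * h′ i j
    distrib : ∀ a b c → (a - b) * c ≡ a * c - b * c
    distrib = solve-∀

  ⊛-comm : ∀ f g n k → (f ⊛ g) n k ≡ (g ⊛ f) n k
  ⊛-comm f g n k = begin
    ∑ (suc n) (λ i → ∑ (suc k) (λ j → f i j * g (n ∸ i) (k ∸ j)))
      ≡⟨ ∑-reverse n (λ i → ∑ (suc k) (λ j → f i j * g (n ∸ i) (k ∸ j))) ⟩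
    ∑ (suc n) (λ i → ∑ (suc k) (λ j → f (n ∸ i) j * g (n ∸ (n ∸ i)) (k ∸ j)))
      ≡⟨ ∑-cong (suc n) (λ {i} _ → ∑-reverse k (λ j → f (n ∸ i) j * g (n ∸ (n ∸ i)) (k ∸ j))) ⟩
    ∑ (suc n) (λ i → ∑ (suc k) (λ j → f (n ∸ i) (k ∸ j) * g (n ∸ (n ∸ i)) (k ∸ (k ∸ j))))
      ≡⟨ ∑-cong (suc n) (λ i<1+n → ∑-cong (suc k) λ j<1+k → swap i<1+n j<1+k) ⟩
    ∑ (suc n) (λ i → ∑ (suc k) (λ j → g i j * f (n ∸ i) (k ∸ j))) ∎
    where
    swap : ∀ {i j} → i < suc n → j < suc k →
           f (n ∸ i) (k ∸ j) * g (n ∸ (n ∸ i)) (k ∸ (k ∸ j)) ≡ g i j * f (n ∸ i) (k ∸ j)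
    swap {i} {j} i<1+n j<1+k = begin
      f (n ∸ i) (k ∸ j) * g (n ∸ (n ∸ i)) (k ∸ (k ∸ j))
        ≡⟨ *-comm (f (n ∸ i) (k ∸ j)) _ ⟩
      g (n ∸ (n ∸ i)) (k ∸ (k ∸ j)) * f (n ∸ i) (k ∸ j)
        ≡⟨ cong₂ (λ i′ j′ → g i′ j′ * f (n ∸ i) (k ∸ j))
                 (m∸[m∸n]≡n (s≤s⁻¹ i<1+n)) (m∸[m∸n]≡n (s≤s⁻¹ j<1+k)) ⟩
      g i j * f (n ∸ i) (k ∸ j) ∎

  monomial : ℕ → ℕ → Series
  monomial i j n k = if (i ≡ᵇ n) ∧ (j ≡ᵇ k) then + 1 else + 0

  shiftBy : ℕ → ℕ → Series → Series
  shiftBy (suc i) j       f zero    k       = + 0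
  shiftBy (suc i) j       f (suc n) k       = shiftBy i j f n k
  shiftBy zero    (suc j) f n       zero    = + 0
  shiftBy zero    (suc j) f n       (suc k) = shiftBy zero j f n k
  shiftBy zero    zero    f n       k       = f n k

  monomial-⊛ : ∀ i j f n k → (monomial i j ⊛ f) n k ≡ shiftBy i j f n k
  monomial-⊛ (suc i) j f zero    k = cong (_+ + 0) (∑-zero (suc k) λ _ → refl)
  monomial-⊛ (suc i) j f (suc n) k =
    trans (∑-suc (suc n) (λ i′ → ∑ (suc k) (λ j′ → monomial (suc i) j i′ j′ * f (suc n ∸ i′) (k ∸ j′))))
          (trans (cong₂ _+_ (∑-zero (suc k) λ _ → refl) (monomial-⊛ i j f n k)) (+-identityˡ _))
  monomial-⊛ zero    j f n       k =
    trans (∑-suc n (λ i′ → ∑ (suc k) (λ j′ → monomial 0 j i′ j′ * f (n ∸ i′) (k ∸ j′))))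
          (trans (cong₂ _+_ (column j k) (∑-zero n λ _ → ∑-zero (suc k) λ _ → refl)) (+-identityʳ _))
    where
    column : ∀ j k → ∑ (suc k) (λ j′ → monomial 0 j 0 j′ * f n (k ∸ j′)) ≡ shiftBy zero j f n k
    column (suc j) zero    = refl
    column (suc j) (suc k) = trans (∑-suc (suc k) (λ j′ → monomial 0 (suc j) 0 j′ * f n (suc k ∸ j′)))
                                   (trans (+-identityˡ _) (column j k))
    column zero    k       = trans (∑-suc k (λ j′ → monomial 0 0 0 j′ * f n (k ∸ j′)))
                                   (trans (cong₂ _+_ (*-identityˡ (f n k)) (∑-zero k λ _ → refl)) (+-identityʳ _))

  ⊛-zS : ∀ f n k → (f ⊛ zS) n k ≡ shiftBy 1 0 f n k
  ⊛-zS f n k = trans (⊛-comm f zS n k) (trans (⊛-congˡ f zS-monomial n k) (monomial-⊛ 1 0 f n k))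
    where
    zS-monomial : ∀ i j → zS i j ≡ monomial 1 0 i j
    zS-monomial zero          j       = refl
    zS-monomial (suc zero)    zero    = refl
    zS-monomial (suc zero)    (suc j) = refl
    zS-monomial (suc (suc i)) j       = refl

open Enumeration using (t·_; a-recurrence)
open PowerSeries
open import Data.Integer using (+_; _+_; _-_)
open import Data.Integer.Properties using (pos-+; +-inverseʳ)
open import Data.Integer.Tactic.RingSolver using (solve-∀)
open ≡-Reasoning

denominator : Series
denominator = monomial 0 0 ⊖ (monomial 1 0 ⊕ monomial 1 0 ⊕ monomial 1 1) ⊕ monomial 2 1

denominator-monomials : ∀ n k → (oneS ⊖ (twoS ⊕ tS) ⊛ zS ⊕ tS ⊛ zS ⊛ zS) n k ≡ denominator n k
denominator-monomials n k =
  trans (cong₂ (λ x y → oneS n k - x + y) (⊛-zS (twoS ⊕ tS) n k) (⊛-zS (tS ⊛ zS) n k)) (coefficients n k)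
  where
  coefficients-suc : ∀ n k →
    oneS (suc n) k - shiftBy 1 0 (twoS ⊕ tS) (suc n) k + shiftBy 1 0 tS n k ≡ denominator (suc n) k
  coefficients-suc zero          zero          = refl
  coefficients-suc zero          (suc zero)    = refl
  coefficients-suc zero          (suc (suc k)) = refl
  coefficients-suc (suc zero)    zero          = refl
  coefficients-suc (suc zero)    (suc zero)    = refl
  coefficients-suc (suc zero)    (suc (suc k)) = refl
  coefficients-suc (suc (suc n)) k             = refl
  coefficients : ∀ n k →
    oneS n k - shiftBy 1 0 (twoS ⊕ tS) n k + shiftBy 1 0 (tS ⊛ zS) n k ≡ denominator n k
  coefficients zero    zero    = refl
  coefficients zero    (suc k) = refl
  coefficients (suc n) k       =
    trans (cong (_+_ (oneS (suc n) k - shiftBy 1 0 (twoS ⊕ tS) (suc n) k)) (⊛-zS tS n k)) (coefficients-suc n k)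

denominator-⊛ : ∀ f n k →
  (denominator ⊛ f) n k ≡ f n k - (shiftBy 1 0 f n k + shiftBy 1 0 f n k + shiftBy 1 1 f n k) + shiftBy 2 1 f n k
denominator-⊛ f n k = begin
  (denominator ⊛ f) n k
    ≡⟨ ⊛-distribʳ-⊕ (m₀₀ ⊖ (m₁₀ ⊕ m₁₀ ⊕ m₁₁)) m₂₁ f n k ⟩
  ((m₀₀ ⊖ (m₁₀ ⊕ m₁₀ ⊕ m₁₁)) ⊛ f) n k + (m₂₁ ⊛ f) n k
    ≡⟨ cong (_+ (m₂₁ ⊛ f) n k) (⊛-distribʳ-⊖ m₀₀ (m₁₀ ⊕ m₁₀ ⊕ m₁₁) f n k) ⟩
  (m₀₀ ⊛ f) n k - ((m₁₀ ⊕ m₁₀ ⊕ m₁₁) ⊛ f) n k + (m₂₁ ⊛ f) n k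
    ≡⟨ cong (λ x → (m₀₀ ⊛ f) n k - x + (m₂₁ ⊛ f) n k)
            (trans (⊛-distribʳ-⊕ (m₁₀ ⊕ m₁₀) m₁₁ f n k)
                   (cong (_+ (m₁₁ ⊛ f) n k) (⊛-distribʳ-⊕ m₁₀ m₁₀ f n k))) ⟩
  (m₀₀ ⊛ f) n k - ((m₁₀ ⊛ f) n k + (m₁₀ ⊛ f) n k + (m₁₁ ⊛ f) n k) + (m₂₁ ⊛ f) n k
    ≡⟨ cong₂ (λ x y → x - y + (m₂₁ ⊛ f) n k) (monomial-⊛ 0 0 f n k)
             (cong₂ _+_ (cong₂ _+_ (monomial-⊛ 1 0 f n k) (monomial-⊛ 1 0 f n k)) (monomial-⊛ 1 1 f n k)) ⟩
  f n k - (shiftBy 1 0 f n k + shiftBy 1 0 f n k + shiftBy 1 1 f n k) + (m₂₁ ⊛ f) n k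
    ≡⟨ cong (_+_ (f n k - (shiftBy 1 0 f n k + shiftBy 1 0 f n k + shiftBy 1 1 f n k))) (monomial-⊛ 2 1 f n k) ⟩
  f n k - (shiftBy 1 0 f n k + shiftBy 1 0 f n k + shiftBy 1 1 f n k) + shiftBy 2 1 f n k ∎
  where
  m₀₀ m₁₀ m₁₁ m₂₁ : Series
  m₀₀ = monomial 0 0
  m₁₀ = monomial 1 0
  m₁₁ = monomial 1 1
  m₂₁ = monomial 2 1

cancel-recurrence : ∀ x y z w → x ℕ.+ w ≡ y ℕ.+ y ℕ.+ z → + x - (+ y + + y + + z) + + w ≡ + 0
cancel-recurrence x y z w eq = begin
  + x - (+ y + + y + + z) + + w          ≡⟨ regroup (+ x) (+ y + + y + + z) (+ w) ⟩
  + x + + w - (+ y + + y + + z)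
    ≡⟨ cong₂ _-_ (pos-+ x w) (trans (pos-+ (y ℕ.+ y) z) (cong (_+ + z) (pos-+ y y))) ⟨
  + (x ℕ.+ w) - + (y ℕ.+ y ℕ.+ z)        ≡⟨ cong (λ m → + m - + (y ℕ.+ y ℕ.+ z)) eq ⟩
  + (y ℕ.+ y ℕ.+ z) - + (y ℕ.+ y ℕ.+ z)  ≡⟨ +-inverseʳ (+ (y ℕ.+ y ℕ.+ z)) ⟩
  + 0                                    ∎
  where
  regroup : ∀ p q r → p - q + r ≡ p + r - q
  regroup = solve-∀

F-recurrence : ∀ n k →
  F n k - (shiftBy 1 0 F n k + shiftBy 1 0 F n k + shiftBy 1 1 F n k) + shiftBy 2 1 F n k ≡
  oneS n k - shiftBy 1 0 (oneS ⊕ tS) n k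
F-recurrence zero          zero          = refl
F-recurrence zero          (suc k)       = refl
F-recurrence (suc zero)    zero          = refl
F-recurrence (suc zero)    (suc zero)    = refl
F-recurrence (suc zero)    (suc (suc k)) = refl
F-recurrence (suc (suc n)) zero          =
  cancel-recurrence (a (2 ℕ.+ n) 0) (a (1 ℕ.+ n) 0) 0 0 (a-recurrence n zero)
F-recurrence (suc (suc n)) (suc k)       =
  cancel-recurrence (a (2 ℕ.+ n) (suc k)) (a (1 ℕ.+ n) (suc k)) (a (1 ℕ.+ n) k) (a n k) (a-recurrence n (suc k))

mainTheorem11 : ∀ (n k : ℕ) →
    ((oneS ⊖ (twoS ⊕ tS) ⊛ zS ⊕ tS ⊛ zS ⊛ zS) ⊛ F) n k ≡ (oneS ⊖ (oneS ⊕ tS) ⊛ zS) n k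
mainTheorem11 n k = begin
  ((oneS ⊖ (twoS ⊕ tS) ⊛ zS ⊕ tS ⊛ zS ⊛ zS) ⊛ F) n k
    ≡⟨ ⊛-congˡ F denominator-monomials n k ⟩
  (denominator ⊛ F) n k
    ≡⟨ denominator-⊛ F n k ⟩
  F n k - (shiftBy 1 0 F n k + shiftBy 1 0 F n k + shiftBy 1 1 F n k) + shiftBy 2 1 F n k
    ≡⟨ F-recurrence n k ⟩
  oneS n k - shiftBy 1 0 (oneS ⊕ tS) n k
    ≡⟨ cong (_-_ (oneS n k)) (⊛-zS (oneS ⊕ tS) n k) ⟨
  (oneS ⊖ (oneS ⊕ tS) ⊛ zS) n k ∎
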